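{- There is an absolute constant $C$ such that for every $B\ge 2$ and every input pair of positive integers $(a,b)$ with $a,b\le B$ and $b$ a norm for $\mathbb{Q}(\sqrt[3]{a})/\mathbb{Q}$, the following algorithm terminates after at most $C(\log B)^2$ iterations: (i) Replace $a$ and $b$ by their cube-free parts. If $a>b$ then swap $a$ and $b$. (ii) If $a=0$ or $a=1$ then stop. (iii) Write $b=b_1b_2^2$ with $b_1,b_2$ positive, coprime and square-free. Choose $c\in\mathbb{Z}$ with $a\equiv c^3\pmod{b_1}$. (iv) Let $F(X,Y)=\frac{1}{b_1}\big((cX+b_1Y)^3-aX^3\big)\in\mathbb{Z}[X,Y]$, and find (by reduction theory) integers $u,v$ with $0<F(u,v)<(27/23)^{1/4}(ab_1)^{1/2}$. (v) If $b_2F(u,v)<\frac34 b$ then replace $(a,b)$ by $(a,b_2F(u,v))$ and go to step (i). (vi) Otherwise replace $(a,b)$ by $(b-a,a^2b)$ and go to step (i).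
   Context: The cube-free part of a positive integer $n$ is $n/m^3$ where $m^3$ is the largest cube dividing $n$ (and the cube-free part of $0$ is $0$). An iteration is one pass through steps (i)–(vi). At each step (iii) such $c$ exists and at each step (iv) such $u,v$ exist (the invariant that $b$ is a norm for $\mathbb{Q}(\sqrt[3]{a})/\mathbb{Q}$ is preserved); the claim concerns the number of iterations performed. -}

module Defs where

open import Data.Nat as ℕ using (ℕ; zero; suc; _+_; _*_; _∸_; _^_; _≤_; _<_)
open import Data.Nat.Divisibility using (_∣_)
open import Data.Nat.Coprimality using (Coprime)
open import Data.Integer as ℤ using (ℤ; +_)
import Data.Integer.Divisibility as ℤD
open import Data.Product using (Σ; _×_; ∃)
open import Data.Sum using (_⊎_)
open import Relation.Binary.PropositionalEquality using (_≡_; _≢_)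
open import Relation.Nullary using (¬_)

CubeFreePart : ℕ → ℕ → Set
CubeFreePart n r =
  (n ≡ 0 × r ≡ 0) ⊎
  (0 < n × Σ ℕ λ m → (m ^ 3) * r ≡ n × (∀ k → (k ^ 3) ∣ n → k ^ 3 ≤ m ^ 3))

SquareFree : ℕ → Set
SquareFree n = ∀ k → (k * k) ∣ n → k ≡ 1

-- b is a norm for Q(a^(1/3))/Q: b = N(r + s α + t α^2) with α^3 = a and
-- r,s,t rational, written with a common denominator d ≠ 0:
--   r^3 + a s^3 + a^2 t^3 - 3 a r s t = b d^3.
IsNorm : ℕ → ℕ → Set
IsNorm a b = Σ ℤ λ r → Σ ℤ λ s → Σ ℤ λ t → Σ ℤ λ d →
  d ≢ + 0 ×
  (r ℤ.^ 3 ℤ.+ (+ a) ℤ.* s ℤ.^ 3 ℤ.+ (+ a) ℤ.^ 2 ℤ.* t ℤ.^ 3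
     ℤ.- (+ 3) ℤ.* (+ a) ℤ.* r ℤ.* s ℤ.* t
   ≡ (+ b) ℤ.* d ℤ.^ 3)

SwapStep : ℕ → ℕ → ℕ → ℕ → Set
SwapStep a b x y = (a ≤ b × x ≡ a × y ≡ b) ⊎ (b < a × x ≡ b × y ≡ a)

-- All admissible choices of c (step (iii)) and u , v (step (iv)) are allowed.
record Iteration (a b a' b' : ℕ) : Set where
  field
    ca cb x y : ℕ
    cfa : CubeFreePart a ca
    cfb : CubeFreePart b cb
    swap : SwapStep ca cb x y
    x≢0 : x ≢ 0
    x≢1 : x ≢ 1
    b₁ b₂ : ℕ
    b₁-pos : 0 < b₁
    b₂-pos : 0 < b₂
    y≡ : y ≡ b₁ * (b₂ ^ 2)
    cop : Coprime b₁ b₂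
    sf₁ : SquareFree b₁
    sf₂ : SquareFree b₂
    c : ℤ
    c-cube : (+ b₁) ℤD.∣ (c ℤ.^ 3 ℤ.- + x)
    -- step (iv): F(u,v) = ((c u + b₁ v)^3 - x u^3) / b₁ = + f with
    -- 0 < f < (27/23)^(1/4) (x b₁)^(1/2), i.e. 23 f^4 < 27 (x b₁)^2 (as f > 0)
    u v : ℤ
    f : ℕ
    F≡ : (+ f) ℤ.* (+ b₁) ≡ (c ℤ.* u ℤ.+ (+ b₁) ℤ.* v) ℤ.^ 3 ℤ.- (+ x) ℤ.* u ℤ.^ 3
    f-pos : 0 < f
    f-small : 23 * f ^ 4 < 27 * (x * b₁) ^ 2
    next : (4 * (b₂ * f) < 3 * y × a' ≡ x × b' ≡ b₂ * f)
         ⊎ (¬ (4 * (b₂ * f) < 3 * y) × a' ≡ y ∸ x × b' ≡ (x ^ 2) * y)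

data Run : ℕ → ℕ → ℕ → Set where
  done : ∀ {a b} → Run 0 a b
  step : ∀ {k a b a' b'} → Iteration a b a' b' → Run k a' b' → Run (suc k) a b

{-# OPTIONS --safe #-}
-- Track m = min(a, b) and p = ab; taking cube-free parts and swapping never increases them.
-- In step (v) the new product x · b₂F(u,v) is below (3/4) xy ≤ (3/4) p while m does not grow.
-- In step (vi), b₂F(u,v) ≥ (3/4) y together with the reduction-theory bound 23 F⁴ < 27 (x b₁)²
-- gives y < (31/16) x, so the new minimum y − x is below (15/16) m and the new product
-- (y − x) x² y is at most 2 m⁴ ≤ 2 B⁴. So there are O(log B) steps of type (vi), and between
-- two of them O(log B⁴) steps of type (v).
module Submission where

open import Defs
open import Data.Nat using (ℕ; suc; _*_; _^_; _≤_)
open import Data.Nat.Logarithm using (⌊log₂_⌋)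
open import Data.Product using (Σ)

open import Data.Empty using (⊥-elim)
open import Data.Nat using (zero; _+_; _∸_; _<_; _⊓_; z≤n; s≤s; NonZero; >-nonZero)
open import Data.Nat.Logarithm using (⌊log₂⌋-mono-≤; ⌊log₂[2^n]⌋≡n)
open import Data.Nat.Properties
open import Algebra.Properties.CommutativeSemigroup *-commutativeSemigroup using (x∙yz≈y∙xz)
open import Data.Nat.Solver using (module +-*-Solver)
open import Data.Product using (_,_; _×_; proj₁; proj₂)
open import Data.Sum using (inj₁; inj₂)
open import Data.Unit using (tt)
open import Relation.Binary.PropositionalEquality

open +-*-Solver using (solve; _:*_; _:^_; _:+_; _:=_; con)

^-distribʳ-* : ∀ m n k → (m * n) ^ k ≡ m ^ k * n ^ k
^-distribʳ-* m n zero    = refl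
^-distribʳ-* m n (suc k) = begin
  m * n * (m * n) ^ k       ≡⟨ cong (m * n *_) (^-distribʳ-* m n k) ⟩
  m * n * (m ^ k * n ^ k)   ≡⟨ solve 4 (λ m n M N → m :* n :* (M :* N) := m :* M :* (n :* N)) refl m n (m ^ k) (n ^ k) ⟩
  m * m ^ k * (n * n ^ k)   ∎
  where open ≡-Reasoning

-- Taking n-th powers turns a contraction by the ratio δ/γ into one by at least 1/2.
^-contraction : ∀ n .{{_ : NonZero n}} γ δ m m′ e →
                2 * δ ^ n ≤ γ ^ n → γ * m′ < δ * m → m ^ n < 2 ^ suc e → m′ ^ n < 2 ^ e
^-contraction n γ δ m m′ e 2δⁿ≤γⁿ γm′<δm mⁿ<2ᵉ⁺¹ = *-cancelˡ-< (γ ^ n) _ _ (begin-strict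
  γ ^ n * m′ ^ n       ≡⟨ ^-distribʳ-* γ m′ n ⟨
  (γ * m′) ^ n         <⟨ ^-monoˡ-< n γm′<δm ⟩
  (δ * m) ^ n          ≡⟨ ^-distribʳ-* δ m n ⟩
  δ ^ n * m ^ n        ≤⟨ *-monoʳ-≤ (δ ^ n) (<⇒≤ mⁿ<2ᵉ⁺¹) ⟩
  δ ^ n * (2 * 2 ^ e)  ≡⟨ x∙yz≈y∙xz (δ ^ n) 2 (2 ^ e) ⟩
  2 * (δ ^ n * 2 ^ e)  ≡⟨ *-assoc 2 (δ ^ n) (2 ^ e) ⟨
  2 * δ ^ n * 2 ^ e    ≤⟨ *-monoˡ-≤ (2 ^ e) 2δⁿ≤γⁿ ⟩
  γ ^ n * 2 ^ e        ∎)
  where open ≤-Reasoning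

<-from-squares : ∀ {α β p q X Y} .{{_ : NonZero q}} →
                 β * q ^ 2 ≤ α * p ^ 2 → α * Y ^ 2 < β * X ^ 2 → q * Y < p * X
<-from-squares {α} {β} {p} {q} {X} {Y} βq²≤αp² αY²<βX² = ≰⇒> λ pX≤qY →
  <⇒≱ αY²<βX² (*-cancelˡ-≤ (q ^ 2) {{m^n≢0 q 2}} (begin
    q ^ 2 * (β * X ^ 2)  ≡⟨ x∙yz≈y∙xz (q ^ 2) β (X ^ 2) ⟩
    β * (q ^ 2 * X ^ 2)  ≡⟨ *-assoc β (q ^ 2) (X ^ 2) ⟨
    β * q ^ 2 * X ^ 2    ≤⟨ *-monoˡ-≤ (X ^ 2) βq²≤αp² ⟩
    α * p ^ 2 * X ^ 2    ≡⟨ *-assoc α (p ^ 2) (X ^ 2) ⟩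
    α * (p ^ 2 * X ^ 2)  ≡⟨ cong (α *_) (^-distribʳ-* p X 2) ⟨
    α * (p * X) ^ 2      ≤⟨ *-monoʳ-≤ α (^-monoˡ-≤ 2 pX≤qY) ⟩
    α * (q * Y) ^ 2      ≡⟨ cong (α *_) (^-distribʳ-* q Y 2) ⟩
    α * (q ^ 2 * Y ^ 2)  ≡⟨ x∙yz≈y∙xz α (q ^ 2) (Y ^ 2) ⟩
    q ^ 2 * (α * Y ^ 2)  ∎))
  where open ≤-Reasoning

1+[m*[1+n]+n]≡[1+m]*[1+n] : ∀ m n → suc (m * suc n + n) ≡ suc m * suc n
1+[m*[1+n]+n]≡[1+m]*[1+n] m n = trans (sym (+-suc (m * suc n) n)) (+-comm (m * suc n) (suc n))

n<2^suc⌊log₂n⌋ : ∀ n → n < 2 ^ suc ⌊log₂ n ⌋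
n<2^suc⌊log₂n⌋ n = ≰⇒> λ 2^suc⌊log₂n⌋≤n → <⇒≱ (n<1+n ⌊log₂ n ⌋)
  (subst (_≤ ⌊log₂ n ⌋) (⌊log₂[2^n]⌋≡n (suc ⌊log₂ n ⌋)) (⌊log₂⌋-mono-≤ 2^suc⌊log₂n⌋≤n))

^-<-2^ : ∀ k {n s} → n < 2 ^ s → n ^ suc k < 2 ^ (s * suc k)
^-<-2^ k {n} {s} n<2ˢ = subst (n ^ suc k <_) (^-*-assoc 2 s (suc k)) (^-monoˡ-< (suc k) n<2ˢ)

n*n≤2*n^4 : ∀ n → n * n ≤ 2 * n ^ 4
n*n≤2*n^4 zero      = z≤n
n*n≤2*n^4 n@(suc _) = begin
  n * n                          ≤⟨ m≤m*n (n * n) (n * n) ⟩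
  n * n * (n * n)                ≤⟨ m≤m+n (n * n * (n * n)) (n * n * (n * n)) ⟩
  n * n * (n * n) + n * n * (n * n) ≡⟨ solve 1 (λ n → n :* n :* (n :* n) :+ n :* n :* (n :* n) := con 2 :* n :^ 4) refl n ⟩
  2 * n ^ 4                      ∎
  where open ≤-Reasoning

c+Ld≤[c+d]L : ∀ c d {L} → 1 ≤ L → c + L * d ≤ (c + d) * L
c+Ld≤[c+d]L c d {L} 1≤L = begin
  c + L * d      ≤⟨ +-monoˡ-≤ (L * d) (m≤m*n c L {{>-nonZero 1≤L}}) ⟩
  c * L + L * d  ≡⟨ cong (c * L +_) (*-comm L d) ⟩
  c * L + d * L  ≡⟨ *-distribʳ-+ L c d ⟨
  (c + d) * L    ∎
  where open ≤-Reasoning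

cubeFreePart-≤ : ∀ {n r} → CubeFreePart n r → r ≤ n
cubeFreePart-≤ (inj₁ (refl , refl)) = z≤n
cubeFreePart-≤ (inj₂ (() , zero , refl , _))
cubeFreePart-≤ {r = r} (inj₂ (_ , suc m , refl , _)) = m≤n*m r (suc m ^ 3)

-- Here y = b₁ b₂², and the last hypothesis is the failure of the test in step (v).
no-descent⇒16y<31x : ∀ {x b₁ b₂ f} .{{_ : NonZero b₁}} .{{_ : NonZero b₂}} →
                     23 * f ^ 4 < 27 * (x * b₁) ^ 2 → 3 * (b₁ * b₂ ^ 2) ≤ 4 * (b₂ * f) →
                     16 * (b₁ * b₂ ^ 2) < 31 * x
no-descent⇒16y<31x {x} {b₁} {b₂} {f} f-small no-descent =
  *-cancelˡ-< b₁ _ _ (subst₂ _<_ (x∙yz≈y∙xz 16 b₁ y) 31xb₁≡b₁31x 16b₁y<31xb₁)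
  where
  open ≤-Reasoning
  y = b₁ * b₂ ^ 2

  3b₁b₂≤4f : 3 * (b₁ * b₂) ≤ 4 * f
  3b₁b₂≤4f = *-cancelʳ-≤ (3 * (b₁ * b₂)) (4 * f) b₂ (subst₂ _≤_
    (solve 2 (λ b₁ b₂ → con 3 :* (b₁ :* b₂ :^ 2) := con 3 :* (b₁ :* b₂) :* b₂) refl b₁ b₂)
    (solve 2 (λ b₂ f → con 4 :* (b₂ :* f) := con 4 :* f :* b₂) refl b₂ f)
    no-descent)

  1863[b₁y]²<6912[xb₁]² : 1863 * (b₁ * y) ^ 2 < 6912 * (x * b₁) ^ 2
  1863[b₁y]²<6912[xb₁]² = begin-strict
    1863 * (b₁ * y) ^ 2        ≡⟨ solve 2 (λ b₁ b₂ → con 1863 :* (b₁ :* (b₁ :* b₂ :^ 2)) :^ 2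
                                              := con 23 :* (con 3 :* (b₁ :* b₂)) :^ 4) refl b₁ b₂ ⟩
    23 * (3 * (b₁ * b₂)) ^ 4   ≤⟨ *-monoʳ-≤ 23 (^-monoˡ-≤ 4 3b₁b₂≤4f) ⟩
    23 * (4 * f) ^ 4           ≡⟨ solve 1 (λ f → con 23 :* (con 4 :* f) :^ 4 := con 256 :* (con 23 :* f :^ 4)) refl f ⟩
    256 * (23 * f ^ 4)         <⟨ *-monoʳ-< 256 f-small ⟩
    256 * (27 * (x * b₁) ^ 2)  ≡⟨ *-assoc 256 27 ((x * b₁) ^ 2) ⟨
    6912 * (x * b₁) ^ 2        ∎

  16b₁y<31xb₁ : 16 * (b₁ * y) < 31 * (x * b₁)
  16b₁y<31xb₁ = <-from-squares {1863} {6912} {31} {16} {x * b₁} {b₁ * y} (≤ᵇ⇒≤ _ _ tt) 1863[b₁y]²<6912[xb₁]²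

  31xb₁≡b₁31x : 31 * (x * b₁) ≡ b₁ * (31 * x)
  31xb₁≡b₁31x = trans (cong (31 *_) (*-comm x b₁)) (x∙yz≈y∙xz 31 b₁ x)

16y<31x⇒step-vi-bounds : ∀ {x y m} → x ≤ y → x ≤ m → 16 * y < 31 * x →
                         16 * (y ∸ x) < 15 * m × (y ∸ x) * (x ^ 2 * y) ≤ 2 * m ^ 4
16y<31x⇒step-vi-bounds {x} {y} {m} x≤y x≤m 16y<31x =
  <-≤-trans 16d<15x (*-monoʳ-≤ 15 x≤m) , d[x²y]≤2m⁴
  where
  open ≤-Reasoning
  d = y ∸ x

  x+d≡y : x + d ≡ y
  x+d≡y = m+[n∸m]≡n x≤y

  16d<15x : 16 * d < 15 * x
  16d<15x = +-cancelˡ-< (16 * x) (16 * d) (15 * x) (begin-strict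
    16 * x + 16 * d  ≡⟨ *-distribˡ-+ 16 x d ⟨
    16 * (x + d)     ≡⟨ cong (16 *_) x+d≡y ⟩
    16 * y           <⟨ 16y<31x ⟩
    31 * x           ≡⟨ *-distribʳ-+ x 16 15 ⟩
    16 * x + 15 * x  ∎)

  d≤m : d ≤ m
  d≤m = ≤-trans (<⇒≤ (*-cancelˡ-< 16 d x (<-≤-trans 16d<15x (*-monoˡ-≤ x (≤ᵇ⇒≤ 15 16 tt))))) x≤m

  d[x²y]≤2m⁴ : d * (x ^ 2 * y) ≤ 2 * m ^ 4
  d[x²y]≤2m⁴ = begin
    d * (x ^ 2 * y)        ≤⟨ *-mono-≤ d≤m (*-mono-≤ (^-monoˡ-≤ 2 x≤m) (subst (_≤ m + m) x+d≡y (+-mono-≤ x≤m d≤m))) ⟩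
    m * (m ^ 2 * (m + m))  ≡⟨ solve 1 (λ m → m :* (m :^ 2 :* (m :+ m)) := con 2 :* m :^ 4) refl m ⟩
    2 * m ^ 4              ∎

data Progress (a b a′ b′ : ℕ) : Set where
  product-shrinks : a′ ⊓ b′ ≤ a ⊓ b → 4 * (a′ * b′) < 3 * (a * b) → Progress a b a′ b′
  minimum-shrinks : 16 * (a′ ⊓ b′) < 15 * (a ⊓ b) → a′ * b′ ≤ 2 * (a ⊓ b) ^ 4 → Progress a b a′ b′

module _ {a b a′ b′} (it : Iteration a b a′ b′) where
  open Iteration it

  private
    x≤y : x ≤ y
    x≤y with swap
    ... | inj₁ (ca≤cb , refl , refl) = ca≤cb
    ... | inj₂ (cb<ca , refl , refl) = <⇒≤ cb<ca

    x≤a⊓b : x ≤ a ⊓ b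
    x≤a⊓b with swap
    ... | inj₁ (ca≤cb , refl , refl) = ⊓-glb (cubeFreePart-≤ cfa) (≤-trans ca≤cb (cubeFreePart-≤ cfb))
    ... | inj₂ (cb<ca , refl , refl) = ⊓-glb (≤-trans (<⇒≤ cb<ca) (cubeFreePart-≤ cfa)) (cubeFreePart-≤ cfb)

    xy≤ab : x * y ≤ a * b
    xy≤ab with swap
    ... | inj₁ (_ , refl , refl) = *-mono-≤ (cubeFreePart-≤ cfa) (cubeFreePart-≤ cfb)
    ... | inj₂ (_ , refl , refl) = subst (_≤ a * b) (*-comm ca cb) (*-mono-≤ (cubeFreePart-≤ cfa) (cubeFreePart-≤ cfb))

  iteration-minimum-positive : 1 ≤ a ⊓ b
  iteration-minimum-positive = ≤-trans (n≢0⇒n>0 x≢0) x≤a⊓b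

  iteration-progress : Progress a b a′ b′
  iteration-progress with next
  ... | inj₁ (descent , a′≡x , b′≡b₂f) = product-shrinks
    (≤-trans (m⊓n≤m a′ b′) (subst (_≤ a ⊓ b) (sym a′≡x) x≤a⊓b))
    (begin-strict
      4 * (a′ * b′)       ≡⟨ x∙yz≈y∙xz 4 a′ b′ ⟩
      a′ * (4 * b′)       ≡⟨ cong₂ (λ u v → u * (4 * v)) a′≡x b′≡b₂f ⟩
      x * (4 * (b₂ * f))  <⟨ *-monoʳ-< x {{>-nonZero (n≢0⇒n>0 x≢0)}} descent ⟩
      x * (3 * y)         ≡⟨ x∙yz≈y∙xz x 3 y ⟩
      3 * (x * y)         ≤⟨ *-monoʳ-≤ 3 xy≤ab ⟩
      3 * (a * b)         ∎)
    where open ≤-Reasoning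
  ... | inj₂ (no-descent , a′≡y∸x , b′≡x²y) = minimum-shrinks
    (≤-<-trans (*-monoʳ-≤ 16 (≤-trans (m⊓n≤m a′ b′) (≤-reflexive a′≡y∸x))) 16[y∸x]<15m)
    (subst (_≤ 2 * (a ⊓ b) ^ 4) (sym (cong₂ _*_ a′≡y∸x b′≡x²y)) [y∸x][x²y]≤2m⁴)
    where
    16y<31x : 16 * y < 31 * x
    16y<31x = subst (λ y → 16 * y < 31 * x) (sym y≡)
      (no-descent⇒16y<31x {x} {b₁} {b₂} {f} {{>-nonZero b₁-pos}} {{>-nonZero b₂-pos}} f-small
        (subst (λ y → 3 * y ≤ 4 * (b₂ * f)) y≡ (≮⇒≥ no-descent)))
    16[y∸x]<15m = proj₁ (16y<31x⇒step-vi-bounds x≤y x≤a⊓b 16y<31x)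
    [y∸x][x²y]≤2m⁴ = proj₂ (16y<31x⇒step-vi-bounds x≤y x≤a⊓b 16y<31x)

-- e and r count the halvings still available to min(a,b)¹¹ and (ab)³; a step of type (vi)
-- spends one unit of e and resets r to Q.
run-length≤budget : ∀ {B Q} → (2 * B ^ 4) ^ 3 < 2 ^ Q →
             ∀ {k a b} e r → Run k a b → a ⊓ b ≤ B → (a ⊓ b) ^ 11 < 2 ^ e → (a * b) ^ 3 < 2 ^ r → r ≤ Q →
             k ≤ e * suc Q + r
run-length≤budget hQ e r done _ _ _ _ = z≤n
run-length≤budget {B} {Q} hQ {suc k} {a} {b} e r (step {a' = a′} {b' = b′} it run) m≤B mᵉ pʳ r≤Q
  with iteration-progress it | iteration-minimum-positive it
... | product-shrinks m′≤m 4p′<3p | 1≤m with r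
...   | zero   = ⊥-elim (<⇒≱ pʳ (^-monoˡ-≤ 3 (*-mono-≤ (≤-trans 1≤m (m⊓n≤m a b)) (≤-trans 1≤m (m⊓n≤n a b)))))
...   | suc r′ = ≤-trans (s≤s (run-length≤budget hQ e r′ run
                   (≤-trans m′≤m m≤B)
                   (≤-<-trans (^-monoˡ-≤ 11 m′≤m) mᵉ)
                   (^-contraction 3 4 3 (a * b) (a′ * b′) r′ (≤ᵇ⇒≤ _ _ tt) 4p′<3p pʳ)
                   (≤-trans (n≤1+n r′) r≤Q)))
                 (≤-reflexive (sym (+-suc (e * suc Q) r′)))
run-length≤budget {B} {Q} hQ {suc k} {a} {b} e r (step {a' = a′} {b' = b′} it run) m≤B mᵉ pʳ r≤Q
    | minimum-shrinks 16m′<15m p′≤2m⁴ | 1≤m with e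
...   | zero    = ⊥-elim (<⇒≱ mᵉ (^-monoˡ-≤ 11 1≤m))
...   | suc e′ = begin
  suc k                    ≤⟨ s≤s (run-length≤budget hQ e′ Q run
                                (≤-trans m′≤m m≤B)
                                (^-contraction 11 16 15 (a ⊓ b) (a′ ⊓ b′) e′ (≤ᵇ⇒≤ _ _ tt) 16m′<15m mᵉ)
                                (≤-<-trans (^-monoˡ-≤ 3 (≤-trans p′≤2m⁴ (*-monoʳ-≤ 2 (^-monoˡ-≤ 4 m≤B)))) hQ)
                                ≤-refl) ⟩
  suc (e′ * suc Q + Q)     ≡⟨ 1+[m*[1+n]+n]≡[1+m]*[1+n] e′ Q ⟩
  suc e′ * suc Q           ≤⟨ m≤m+n (suc e′ * suc Q) r ⟩
  suc e′ * suc Q + r       ∎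
  where
  open ≤-Reasoning
  m′≤m : a′ ⊓ b′ ≤ a ⊓ b
  m′≤m = <⇒≤ (*-cancelˡ-< 16 (a′ ⊓ b′) (a ⊓ b) (<-≤-trans 16m′<15m (*-monoˡ-≤ (a ⊓ b) (≤ᵇ⇒≤ 15 16 tt))))

run-length-bound : ∀ {B s k a b} → B < 2 ^ s → a ≤ B → b ≤ B → Run k a b →
                   suc k ≤ suc (s * 11) * suc (s * 12 + 3)
run-length-bound {B} {s} {k} {a} {b} B<2ˢ a≤B b≤B run = begin
  suc k                              ≤⟨ s≤s (run-length≤budget 2B⁴³<2^Q (s * 11) Q run a⊓b≤B [a⊓b]¹¹<2^e [ab]³<2^Q ≤-refl) ⟩
  suc (s * 11 * suc Q + Q)           ≡⟨ 1+[m*[1+n]+n]≡[1+m]*[1+n] (s * 11) Q ⟩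
  suc (s * 11) * suc Q               ∎
  where
  open ≤-Reasoning
  Q = s * 12 + 3

  a⊓b≤B : a ⊓ b ≤ B
  a⊓b≤B = ≤-trans (m⊓n≤m a b) a≤B

  [a⊓b]¹¹<2^e : (a ⊓ b) ^ 11 < 2 ^ (s * 11)
  [a⊓b]¹¹<2^e = ≤-<-trans (^-monoˡ-≤ 11 a⊓b≤B) (^-<-2^ 10 {B} {s} B<2ˢ)

  2B⁴³<2^Q : (2 * B ^ 4) ^ 3 < 2 ^ Q
  2B⁴³<2^Q = begin-strict
    (2 * B ^ 4) ^ 3     ≡⟨ solve 1 (λ B → (con 2 :* B :^ 4) :^ 3 := B :^ 12 :* con 8) refl B ⟩
    B ^ 12 * 8          <⟨ *-monoˡ-< 8 (^-<-2^ 11 {B} {s} B<2ˢ) ⟩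
    2 ^ (s * 12) * 8    ≡⟨ ^-distribˡ-+-* 2 (s * 12) 3 ⟨
    2 ^ Q               ∎

  [ab]³<2^Q : (a * b) ^ 3 < 2 ^ Q
  [ab]³<2^Q = ≤-<-trans (^-monoˡ-≤ 3 (≤-trans (*-mono-≤ a≤B b≤B) (n*n≤2*n^4 B))) 2B⁴³<2^Q

theorem3p7 : Σ ℕ λ C → ∀ B → 2 ≤ B → ∀ a b → 1 ≤ a → a ≤ B → 1 ≤ b → b ≤ B →
    IsNorm a b → ∀ k → Run k a b → suc k ≤ C * (⌊log₂ B ⌋ ^ 2)
-- The norm hypothesis only guarantees that steps (iii) and (iv) can be carried out; the bound
-- holds for every run.
theorem3p7 = 644 , λ B 2≤B a b _ a≤B _ b≤B _ k run →
  let L = ⌊log₂ B ⌋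
      1≤L = subst (_≤ L) (⌊log₂[2^n]⌋≡n 1) (⌊log₂⌋-mono-≤ 2≤B)
  in begin
    suc k                                    ≤⟨ run-length-bound {s = suc L} (n<2^suc⌊log₂n⌋ B) a≤B b≤B run ⟩
    suc (suc L * 11) * suc (suc L * 12 + 3)  ≡⟨ cong (λ t → suc (suc L * 11) * suc t) (+-comm (suc L * 12) 3) ⟩
    (12 + L * 11) * (16 + L * 12)            ≤⟨ *-mono-≤ (c+Ld≤[c+d]L 12 11 {L} 1≤L) (c+Ld≤[c+d]L 16 12 {L} 1≤L) ⟩
    (23 * L) * (28 * L)                      ≡⟨ solve 1 (λ L → con 23 :* L :* (con 28 :* L) := con 644 :* L :^ 2) refl L ⟩
    644 * L ^ 2                              ∎
  where open ≤-Reasoning
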